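{- Let $k$ be a positive integer and let $G$ be a finite simple graph in which the maximum size of a distance-$k$ matching equals the maximum size of a distance-$2k$ matching. Then $G$ is $k$-equimatchable.
   Context: The distance between two edges $e_1,e_2$ is $\min_{u\in e_1,v\in e_2}\mathrm{dist}_G(u,v)$. A distance-$k$ matching is a set of edges with all pairwise distances between distinct edges at least $k$; it is maximal if not contained in another distance-$k$ matching. A graph is $k$-equimatchable if all its maximal distance-$k$ matchings have the same size. -}

module Defs where

open import Data.Nat using (ℕ; zero; suc; _≤_; _*_)
open import Data.Fin using (Fin)
open import Data.Bool using (Bool; T)
open import Data.Product using (Σ; _×_; _,_; ∃)
open import Data.Sum using (_⊎_)
open import Data.List using (List; length; _∷_)
open import Relation.Binary.PropositionalEquality using (_≡_; _≢_)
open import Relation.Nullary using (¬_)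

record Graph : Set where
  field
    n     : ℕ
    adj   : Fin n → Fin n → Bool
    sym   : ∀ u v → adj u v ≡ adj v u
    irref : ∀ u → adj u u ≡ Bool.false
open Graph public

module _ (G : Graph) where

  Vertex : Set
  Vertex = Fin (n G)

  data Walk : Vertex → Vertex → ℕ → Set where
    here : ∀ {u} → Walk u u 0
    step : ∀ {u v w ℓ} → T (adj G u v) → Walk v w ℓ → Walk u w (suc ℓ)

  -- dist_G(u,v) ≥ d  (dist = ∞ when there is no walk)
  DistGE : Vertex → Vertex → ℕ → Set
  DistGE u v d = ∀ ℓ → Walk u v ℓ → d ≤ ℓ

  Edge : Set
  Edge = Σ Vertex λ u → Σ Vertex λ v → T (adj G u v)

  _∈ₑ_ : Vertex → Edge → Set
  x ∈ₑ (u , v , _) = x ≡ u ⊎ x ≡ v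

  EdgeDistGE : Edge → Edge → ℕ → Set
  EdgeDistGE e₁ e₂ d = ∀ x y → x ∈ₑ e₁ → y ∈ₑ e₂ → DistGE x y d

  -- a distance-k matching: a list of edges, any two at distinct positions
  -- have distance ≥ k (for k ≥ 1 this also forces the edges to be distinct,
  -- so the length of the list is the number of edges)
  IsDistMatching : ℕ → List Edge → Set
  IsDistMatching k M =
    ∀ (i j : Fin (length M)) → i ≢ j →
      EdgeDistGE (Data.List.lookup M i) (Data.List.lookup M j) k

  IsMaximalDistMatching : ℕ → List Edge → Set
  IsMaximalDistMatching k M =
    IsDistMatching k M × (∀ e → ¬ IsDistMatching k (e ∷ M))

  IsMaxDistMatchingSize : ℕ → ℕ → Set
  IsMaxDistMatchingSize k m =
    (Σ (List Edge) λ M → IsDistMatching k M × length M ≡ m) ×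
    (∀ M → IsDistMatching k M → length M ≤ m)

  IsEquimatchable : ℕ → Set
  IsEquimatchable k =
    ∀ M M' → IsMaximalDistMatching k M → IsMaximalDistMatching k M' →
      length M ≡ length M'

-- Let M* be a distance-2k matching of maximum size m and M any maximal
-- distance-k matching.  By maximality every edge of M* lies at distance < k
-- from some edge of M, and no edge of M can be that close to two edges of M*,
-- since the triangle inequality through it would put them at distance < 2k.
-- So M* injects into M and m ≤ |M|; as |M| ≤ m trivially, every maximal
-- distance-k matching has size m.  Edge distances are not decided here, so
-- the argument runs under double negation, which is harmless because the
-- goal m ≤ |M| is decidable.
module Submission where

open import Defs
open import Data.Nat using (ℕ; zero; suc; _+_; _*_; _≤_; _≤?_; z≤n; s≤s)
open import Data.Nat.Properties
  using (+-suc; +-identityʳ; ≤-antisym; ≰⇒>; +-mono-≤; +-monoˡ-≤; ≤-trans; <⇒≱)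
open import Data.Fin as Fin using (Fin)
open import Data.Fin.Properties using (pigeonhole; <⇒≢)
open import Data.Bool using (T)
open import Data.Product using (Σ; ∃; _×_; _,_; proj₁)
open import Data.Sum using (inj₁; inj₂)
open import Data.List using (List; length; _∷_; lookup)
open import Data.Empty using (⊥; ⊥-elim)
open import Relation.Nullary using (¬_)
open import Relation.Nullary.Decidable.Core using (decidable-stable)
open import Relation.Binary.PropositionalEquality as ≡ using (_≡_; refl; trans; subst; cong)

¬¬-finite-choice : ∀ {m} {B : Set} {R : Fin m → B → Set} →
  (∀ i → ¬ ¬ Σ B (R i)) → ¬ ¬ (Σ (Fin m → B) λ φ → ∀ i → R i (φ i))
¬¬-finite-choice {zero}          h k = k ((λ ()) , (λ ()))
¬¬-finite-choice {suc m} {B} {R} h k =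
  h Fin.zero λ (b₀ , r₀) →
  ¬¬-finite-choice {m} {B} {λ i → R (Fin.suc i)} (λ i → h (Fin.suc i)) λ (φ , r) →
  k ( (λ { Fin.zero → b₀ ; (Fin.suc i) → φ i })
    , (λ { Fin.zero → r₀ ; (Fin.suc i) → r i }) )

module _ (G : Graph) where

  adj-sym : ∀ {u v} → T (adj G u v) → T (adj G v u)
  adj-sym {u} {v} = subst T (Graph.sym G u v)

  _++ʷ_ : ∀ {a b c l m} → Walk G a b l → Walk G b c m → Walk G a c (l + m)
  here     ++ʷ w′ = w′
  step a w ++ʷ w′ = step a (w ++ʷ w′)

  reverse-onto : ∀ {a b c l m} → Walk G a b l → Walk G a c m → Walk G b c (l + m)
  reverse-onto here acc = acc
  reverse-onto {l = suc l} {m} (step a w) acc =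
    subst (Walk G _ _) (+-suc l m) (reverse-onto w (step (adj-sym a) acc))

  reverse : ∀ {a b l} → Walk G a b l → Walk G b a l
  reverse {l = l} w = subst (Walk G _ _) (+-identityʳ l) (reverse-onto w here)

  endpoints-walk : ∀ (e : Edge G) {y y′} → _∈ₑ_ G y e → _∈ₑ_ G y′ e →
    Σ ℕ λ l → Walk G y y′ l × l ≤ 1
  endpoints-walk (u , v , a) (inj₁ refl) (inj₁ refl) = 0 , here , z≤n
  endpoints-walk (u , v , a) (inj₁ refl) (inj₂ refl) = 1 , step a here , s≤s z≤n
  endpoints-walk (u , v , a) (inj₂ refl) (inj₁ refl) = 1 , step (adj-sym a) here , s≤s z≤n
  endpoints-walk (u , v , a) (inj₂ refl) (inj₂ refl) = 0 , here , z≤n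

  EdgeDistGE-sym : ∀ {e₁ e₂ d} → EdgeDistGE G e₁ e₂ d → EdgeDistGE G e₂ e₁ d
  EdgeDistGE-sym h x y x∈ y∈ ℓ w = h y x y∈ x∈ ℓ (reverse w)

  EdgeDistGE-stable : ∀ {e₁ e₂ d} → ¬ ¬ EdgeDistGE G e₁ e₂ d → EdgeDistGE G e₁ e₂ d
  EdgeDistGE-stable {d = d} ¬¬h x y x∈ y∈ ℓ w =
    decidable-stable (d ≤? ℓ) λ d≰ℓ → ¬¬h λ h → d≰ℓ (h x y x∈ y∈ ℓ w)

  -- A walk f → e → f′ has length ℓ + l₀ + ℓ′ ≤ (k - 1) + 1 + (k - 1) < 2k.
  EdgeDistGE-triangle : ∀ k (f f′ e : Edge G) → EdgeDistGE G f f′ (2 * k) →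
    ¬ EdgeDistGE G f e k → ¬ EdgeDistGE G f′ e k → ⊥
  EdgeDistGE-triangle k f f′ e far close close′ =
    close λ x y x∈ y∈ ℓ w →
    decidable-stable (k ≤? ℓ) λ k≰ℓ →
    close′ λ x′ y′ x′∈ y′∈ ℓ′ w′ →
    decidable-stable (k ≤? ℓ′) λ k≰ℓ′ →
    let (l₀ , w₀ , l₀≤1) = endpoints-walk e y∈ y′∈
        short : suc (ℓ + (l₀ + ℓ′)) ≤ 2 * k
        short = subst (suc (ℓ + (l₀ + ℓ′)) ≤_) (cong (k +_) (≡.sym (+-identityʳ k)))
                  (+-mono-≤ (≰⇒> k≰ℓ) (≤-trans (+-monoˡ-≤ ℓ′ l₀≤1) (≰⇒> k≰ℓ′)))
    in <⇒≱ short (far x x′ x∈ x′∈ _ (w ++ʷ (w₀ ++ʷ reverse w′)))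

  ∷-isDistMatching : ∀ k (f : Edge G) M → IsDistMatching G k M →
    ¬ (Σ (Fin (length M)) λ j → ¬ EdgeDistGE G f (lookup M j) k) →
    IsDistMatching G k (f ∷ M)
  ∷-isDistMatching k f M dM none Fin.zero    Fin.zero    i≢j = ⊥-elim (i≢j refl)
  ∷-isDistMatching k f M dM none Fin.zero    (Fin.suc j) _   =
    EdgeDistGE-stable {f} {lookup M j} λ near → none (j , near)
  ∷-isDistMatching k f M dM none (Fin.suc i) Fin.zero    _   =
    EdgeDistGE-sym {f} {lookup M i} (EdgeDistGE-stable {f} {lookup M i} λ near → none (i , near))
  ∷-isDistMatching k f M dM none (Fin.suc i) (Fin.suc j) i≢j =
    dM i j (λ i≡j → i≢j (cong Fin.suc i≡j))

  maximal⇒dominating : ∀ k M → IsMaximalDistMatching G k M → ∀ f →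
    ¬ ¬ (Σ (Fin (length M)) λ j → ¬ EdgeDistGE G f (lookup M j) k)
  maximal⇒dominating k M (dM , maxM) f none = maxM f (∷-isDistMatching k f M dM none)

  -- Pick for each edge of M* a nearby edge of M; by pigeonhole two edges of
  -- M* would share one, contradicting EdgeDistGE-triangle.
  distMatching2k-length≤maximal : ∀ k M* → IsDistMatching G (2 * k) M* →
    ∀ M → IsMaximalDistMatching G k M → length M* ≤ length M
  distMatching2k-length≤maximal k M* d* M maxM =
    decidable-stable (length M* ≤? length M) λ M*≰M →
    ¬¬-finite-choice (λ i → maximal⇒dominating k M maxM (lookup M* i)) λ (φ , near) →
    let (i , i′ , i<i′ , φi≡φi′) = pigeonhole (≰⇒> M*≰M) φ
    in EdgeDistGE-triangle k (lookup M* i) (lookup M* i′) (lookup M (φ i))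
         (d* i i′ (<⇒≢ i<i′)) (near i)
         (subst (λ j → ¬ EdgeDistGE G (lookup M* i′) (lookup M j) k) (≡.sym φi≡φi′) (near i′))

corollary5 : (k : ℕ) → 1 ≤ k → (G : Graph) →
    (∃ λ m → IsMaxDistMatchingSize G k m × IsMaxDistMatchingSize G (2 * k) m) →
    IsEquimatchable G k
corollary5 k _ G (m , (_ , ≤m) , ((M* , d* , |M*|≡m) , _)) M M′ maxM maxM′ =
  trans (length≡m M maxM) (≡.sym (length≡m M′ maxM′))
  where
    length≡m : ∀ N → IsMaximalDistMatching G k N → length N ≡ m
    length≡m N maxN = ≤-antisym (≤m N (proj₁ maxN))
      (subst (_≤ length N) |M*|≡m (distMatching2k-length≤maximal G k M* d* N maxN))
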